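{- Let $k\ge 2$ be an integer, let $\gamma,d,\varepsilon$ be real numbers, and let $\mathcal{G}$ be a graph on $\ell$ vertices such that for all nonadjacent $x,y\in V(\mathcal{G})$, \[ d(x)+d(y)\ge 2\left(1-\frac{1}{k-1}+\gamma-d-2\varepsilon\right)\ell . \] Let $\Phi=\{\Phi_k,\ldots,\Phi_1\}$ be a maximal $k$-clique-cover of $\mathcal{G}$, let $\varphi_i=|\Phi_i|/\ell$ for $i\in[1,k]$, and let $i_0=\min\{i\in[1,k]:|\Phi_i|\ge k\}$. Assume that $i_0<k$ and $\varphi_i=0$ for all $i<i_0$. Then \[ \varphi_k\ge \sum_{i=2}^{k-i_0}(i-1)\varphi_{k-i}+(k-1)\gamma-(k-1)(d+2\varepsilon). \]
   Context: A $k$-clique-cover $\Phi=\{\Phi_k,\Phi_{k-1},\ldots,\Phi_1\}$ of $\mathcal{G}$ is a collection of pairwise vertex-disjoint cliques of $\mathcal{G}$ whose vertex sets cover $V(\mathcal{G})$, where $\Phi_i$ is the set of cliques of order $i$ in the collection ($i\in[1,k]$). It is maximal if the vector $(|\Phi_k|,|\Phi_{k-1}|,\ldots,|\Phi_1|)$ is lexicographically maximal among all $k$-clique-covers of $\mathcal{G}$. $[p,q]=\{i\in\mathbb{Z}:p\le i\le q\}$.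
   Formalization: The parameters γ, d and ε are rational numbers rather than real numbers. -}

module Defs where

open import Data.Bool using (Bool; true; false; if_then_else_)
open import Data.Nat as ℕ using (ℕ; zero; suc; _∸_; _+_)
open import Data.Fin using (Fin)
open import Data.List using (List; []; _∷_; length; map; filter; concat; upTo; foldr; allFin)
open import Data.Nat.ListAction using (sum)
open import Data.List.Relation.Unary.All using (All)
open import Data.List.Relation.Unary.AllPairs using (AllPairs)
open import Data.List.Relation.Binary.Permutation.Propositional using (_↭_)
open import Data.Integer using (+_)
open import Data.Rational as ℚ using (ℚ; _/_; 0ℚ)
open import Data.Product using (_×_)
open import Data.Sum using (_⊎_)
open import Relation.Binary.PropositionalEquality using (_≡_)

record Graph (ℓ : ℕ) : Set where
  field
    adj     : Fin ℓ → Fin ℓ → Bool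
    adj-sym : ∀ x y → adj x y ≡ adj y x
    irrefl  : ∀ x → adj x x ≡ false
open Graph public

deg : ∀ {ℓ} → Graph ℓ → Fin ℓ → ℕ
deg {ℓ} G x = sum (map (λ y → if adj G x y then 1 else 0) (allFin ℓ))

-- A clique of G: a list of vertices that are pairwise adjacent
-- (hence pairwise distinct, by irreflexivity). Its order is its length.
IsClique : ∀ {ℓ} → Graph ℓ → List (Fin ℓ) → Set
IsClique G c = AllPairs (λ x y → adj G x y ≡ true) c

-- Disjointness + covering is
-- expressed by: the concatenation of the cliques is a permutation of V(G).
record CliqueCover {ℓ} (k : ℕ) (G : Graph ℓ) : Set where
  field
    cliques  : List (List (Fin ℓ))
    areCliques : All (IsClique G) cliques
    orders   : All (λ c → 1 ℕ.≤ length c × length c ℕ.≤ k) cliques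
    partition : concat cliques ↭ allFin ℓ
open CliqueCover public

count : ∀ {ℓ k} {G : Graph ℓ} → CliqueCover k G → ℕ → ℕ
count Φ i = length (filter (λ c → length c ℕ.≟ i) (cliques Φ))

countVec : ∀ {ℓ k} {G : Graph ℓ} → CliqueCover k G → List ℕ
countVec {k = k} Φ = map (λ j → count Φ (k ∸ j)) (upTo k)

data LexLe : List ℕ → List ℕ → Set where
  lex-[] : LexLe [] []
  lex-<  : ∀ {a b as bs} → a ℕ.< b → length as ≡ length bs → LexLe (a ∷ as) (b ∷ bs)
  lex-≡  : ∀ {a as bs} → LexLe as bs → LexLe (a ∷ as) (a ∷ bs)

IsMaximal : ∀ {ℓ k} {G : Graph ℓ} → CliqueCover k G → Set
IsMaximal {k = k} {G = G} Φ = ∀ (Ψ : CliqueCover k G) → LexLe (countVec Ψ) (countVec Φ)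

-- a / b as a rational (b = 0 gives 0; only used with b ≠ 0)
frac : ℕ → ℕ → ℚ
frac a zero    = 0ℚ
frac a (suc n) = (+ a) / suc n

nat : ℕ → ℚ
nat n = frac n 1

φ : ∀ {ℓ k} {G : Graph ℓ} → CliqueCover k G → ℕ → ℚ
φ {ℓ = ℓ} Φ i = frac (count Φ i) ℓ

-- Σ_{i=a}^{b} f i   (empty if b < a)
sumFromTo : ℕ → ℕ → (ℕ → ℚ) → ℚ
sumFromTo a b f = foldr ℚ._+_ 0ℚ (map (λ j → f (a + j)) (upTo (suc b ∸ a)))

{-# OPTIONS --safe #-}
-- Let a = i₀, let W be the n = a |Φ_a| vertices of the cliques of order a and T the sum of
-- their degrees. Maximality forbids every exchange of vertices that raises the count vector: a
-- vertex of W is never complete to another cover clique of order below k, and if it is complete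
-- to a k-clique Q then every vertex of Q misses a vertex of each other clique of order a.
-- Counting the edges between W and each cover clique gives T ≤ n (ℓ − |Φ|), and averaging over W
-- yields nonadjacent x, y with d(x) + d(y) ≤ 2T / n ≤ 2 (ℓ − |Φ|): otherwise the vertices of W of
-- degree below T / n would form a clique, hence number at most a, and could not make up for the
-- at least a non-neighbours of a vertex of minimum degree m, whose degrees exceed 2T / n − m.
-- So the degree hypothesis bounds the number |Φ| of cliques from above, whereas
-- Σ_C (k − 1 − |C|) = (k − 1) |Φ| − ℓ is at least Σ_{i=2}^{k−a} (i − 1) |Φ_{k−i}| − |Φ_k|.
module Submission where

open import Defs
open import Data.Bool as Bool using (true; false; if_then_else_)
open import Data.Bool.Properties using (¬-not)
open import Data.Empty using (⊥; ⊥-elim)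
open import Data.Fin as Fin using (Fin)
import Data.Fin.Properties as Fin
import Data.Integer as ℤ
import Data.Integer.Properties as ℤ
open import Data.List
  using (List; []; _∷_; _++_; length; map; filter; concat; take; upTo; applyUpTo; allFin; foldr)
open import Data.List.Extrema.Nat using (argmin; argmin-all; f[argmin]≤f[xs])
open import Data.List.Membership.Propositional using (_∈_; _∉_; find; lose)
open import Data.List.Membership.Propositional.Properties
  using (∈-∃++; ∈-++⁺ʳ; ∈-concat⁺′; ∈-concat⁻′; ∈-filter⁺; ∈-filter⁻; ∈-allFin)
open import Data.List.Membership.Propositional.Properties.WithK using (unique∧set⇒bag)
open import Data.List.Properties
  using (length-++; concat-++; filter-++; filter-none; filter-some; length-filter;
         length-take; map-upTo; length-tabulate; partition-defn; map-∘)
open import Data.List.Relation.Binary.BagAndSetEquality using (∼bag⇒↭)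
open import Data.List.Relation.Binary.Permutation.Propositional
  using (_↭_; ↭-refl; ↭-sym; ↭-trans; ↭-reflexive; ↭-prep; ↭-swap; ↭⇒↭ₛ; ↭ₛ⇒↭;
         module PermutationReasoning)
  renaming (refl to ↭-base; prep to ↭-cons; swap to ↭-exch; trans to ↭-comp)
open import Data.List.Relation.Binary.Permutation.Propositional.Properties
  using (++⁺ˡ; ++⁺ʳ; ++⁺; shift; shifts; All-resp-↭; ∈-resp-↭; ↭-length; map⁺; filter-↭)
import Data.List.Relation.Binary.Permutation.Setoid.Properties as PermutationSetoid
open import Data.List.Relation.Unary.All as All using (All; []; _∷_)
import Data.List.Relation.Unary.All.Properties as All
open import Data.List.Relation.Unary.AllPairs as AllPairs using (AllPairs; []; _∷_)
import Data.List.Relation.Unary.AllPairs.Properties as AllPairs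
open import Data.List.Relation.Unary.Any as Any using (Any; here; there)
open import Data.List.Relation.Unary.Unique.Propositional using (Unique)
import Data.List.Relation.Unary.Unique.Propositional.Properties as Unique
open import Data.Nat as ℕ using (ℕ; zero; suc; z≤n; s≤s; z<s)
open import Data.Nat.ListAction using (sum)
open import Data.Nat.ListAction.Properties using (sum-↭)
open import Data.Nat.Properties
open import Algebra.Properties.CommutativeSemigroup +-commutativeSemigroup
  using () renaming (interchange to +-interchange)
open import Data.Nat.Tactic.RingSolver using (solve-∀)
open import Data.Product using (∃; _×_; _,_; proj₁; proj₂)
open import Data.Rational as ℚ using (ℚ; 0ℚ; 1ℚ; toℚᵘ)
import Data.Rational.Properties as ℚ
open import Data.Rational.Unnormalised as ℚᵘ using (mkℚᵘ; *≡*; *≤*) renaming (_≃_ to _≃ᵘ_)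
import Data.Rational.Unnormalised.Properties as ℚᵘ
open import Data.Sum using (inj₁; inj₂)
open import Function using (_∘_)
open import Function.Bundles using (mk⇔)
open import Relation.Binary.PropositionalEquality
open import Relation.Nullary using (¬_; Dec; yes; no; ¬?; contradiction; _×-dec_)
open import Relation.Unary using (Decidable)
open import Relation.Unary.Properties using (∁?)

-- ℕ's arithmetic is opened only inside this block, since the statement reads _+_, _-_, _*_ in ℚ.
module _ where
  open import Data.Nat using (_+_; _*_; _∸_; _≤_; _<_; _≟_; _≡ᵇ_)

  private
    variable
      A B : Set

  -- Lists and finite sums

  concat-↭ : {xss yss : List (List A)} → xss ↭ yss → concat xss ↭ concat yss
  concat-↭ ↭-base           = ↭-refl
  concat-↭ (↭-cons xs p)    = ++⁺ˡ xs (concat-↭ p)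
  concat-↭ (↭-exch xs ys p) = ↭-trans (shifts xs ys) (++⁺ˡ ys (++⁺ˡ xs (concat-↭ p)))
  concat-↭ (↭-comp p q)     = ↭-trans (concat-↭ p) (concat-↭ q)

  AllPairs-resp-↭ : {R : A → A → Set} → (∀ {x y} → R x y → R y x) →
                    {xs ys : List A} → xs ↭ ys → AllPairs R xs → AllPairs R ys
  AllPairs-resp-↭ {A = A} {R} sym p = PermutationSetoid.AllPairs-resp-↭ (setoid A) sym (resp₂ R) (↭⇒↭ₛ p)

  Unique-resp-↭ : {xs ys : List A} → xs ↭ ys → Unique xs → Unique ys
  Unique-resp-↭ {A = A} p = PermutationSetoid.Unique-resp-↭ (setoid A) (↭⇒↭ₛ p)

  filter-partition-↭ : {P : A → Set} (P? : Decidable P) (xs : List A) →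
                       xs ↭ filter P? xs ++ filter (∁? P?) xs
  filter-partition-↭ {A = A} P? xs =
    subst (λ (ys , zs) → xs ↭ ys ++ zs) (partition-defn P? xs)
          (↭ₛ⇒↭ (PermutationSetoid.partition-↭ (setoid A) P? xs))

  Unique-++⁻ˡ : (xs : List A) {ys : List A} → Unique (xs ++ ys) → Unique xs
  Unique-++⁻ˡ []       _       = []
  Unique-++⁻ˡ (x ∷ xs) (d ∷ u) = All.++⁻ˡ xs d ∷ Unique-++⁻ˡ xs u

  Unique-++⁻ʳ : (xs : List A) {ys : List A} → Unique (xs ++ ys) → Unique ys
  Unique-++⁻ʳ []       u       = u
  Unique-++⁻ʳ (x ∷ xs) (_ ∷ u) = Unique-++⁻ʳ xs u

  Unique-++-disjoint : (xs : List A) {ys : List A} {v : A} → Unique (xs ++ ys) → v ∈ xs → v ∉ ys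
  Unique-++-disjoint (x ∷ xs) (d ∷ u) (here refl) v∈ys = All.lookup d (∈-++⁺ʳ xs v∈ys) refl
  Unique-++-disjoint (x ∷ xs) (_ ∷ u) (there v∈xs) = Unique-++-disjoint xs u v∈xs

  ∈⇒↭-∷ : {v : A} {xs : List A} → v ∈ xs → ∃ λ rest → xs ↭ v ∷ rest
  ∈⇒↭-∷ v∈ with ys , zs , refl ← ∈-∃++ v∈ = ys ++ zs , shift _ ys zs

  ∈-↭-∷-≢ : {v w : A} {xs rest : List A} → xs ↭ v ∷ rest → w ∈ xs → w ≢ v → w ∈ rest
  ∈-↭-∷-≢ p w∈ w≢v with ∈-resp-↭ p w∈
  ... | here w≡v  = contradiction w≡v w≢v
  ... | there w∈r = w∈r

  ↭-split₃ : {x y z : A} {xs : List A} → x ∈ xs → y ∈ xs → z ∈ xs → y ≢ x → z ≢ x → z ≢ y →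
             ∃ λ rest → xs ↭ x ∷ y ∷ z ∷ rest
  ↭-split₃ x∈ y∈ z∈ y≢x z≢x z≢y
    with r₁ , xs↭ ← ∈⇒↭-∷ x∈
    with r₂ , r₁↭ ← ∈⇒↭-∷ (∈-↭-∷-≢ xs↭ y∈ y≢x)
    with r₃ , r₂↭ ← ∈⇒↭-∷ (∈-↭-∷-≢ r₁↭ (∈-↭-∷-≢ xs↭ z∈ z≢x) z≢y)
    = r₃ , ↭-trans xs↭ (↭-prep _ (↭-trans r₁↭ (↭-prep _ r₂↭)))

  Unique-concat⇒≡ : {L : List (List A)} → Unique (concat L) →
                    ∀ {v C D} → v ∈ C → C ∈ L → v ∈ D → D ∈ L → C ≡ D
  Unique-concat⇒≡ {L = E ∷ L} u v∈C (here refl) v∈D (here refl) = refl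
  Unique-concat⇒≡ {L = E ∷ L} u v∈C (here refl) v∈D (there D∈) =
    contradiction (∈-concat⁺′ v∈D D∈) (Unique-++-disjoint E u v∈C)
  Unique-concat⇒≡ {L = E ∷ L} u v∈C (there C∈) v∈D (here refl) =
    contradiction (∈-concat⁺′ v∈C C∈) (Unique-++-disjoint E u v∈D)
  Unique-concat⇒≡ {L = E ∷ L} u v∈C (there C∈) v∈D (there D∈) =
    Unique-concat⇒≡ (Unique-++⁻ʳ E u) v∈C C∈ v∈D D∈

  Unique-concat-filter : {P : List A → Set} (P? : Decidable P) {L : List (List A)} →
                         Unique (concat L) → Unique (concat (filter P? L))
  Unique-concat-filter P? {L} u = Unique-++⁻ˡ (concat (filter P? L)) (Unique-resp-↭ split u)
    where
    split : concat L ↭ concat (filter P? L) ++ concat (filter (∁? P?) L)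
    split = ↭-trans (concat-↭ (filter-partition-↭ P? L)) (↭-reflexive (sym (concat-++ (filter P? L) _)))

  0<length⇒∈ : {xs : List A} → 0 < length xs → ∃ λ x → x ∈ xs
  0<length⇒∈ {xs = x ∷ _} _ = x , here refl

  ∈-take⁻ : ∀ n {xs : List A} {v : A} → v ∈ take n xs → v ∈ xs
  ∈-take⁻ (suc n) {x ∷ xs} (here v≡x) = here v≡x
  ∈-take⁻ (suc n) {x ∷ xs} (there v∈) = there (∈-take⁻ n v∈)

  filter-concat : {P : A → Set} (P? : Decidable P) (xss : List (List A)) →
                  filter P? (concat xss) ≡ concat (map (filter P?) xss)
  filter-concat P? []         = refl
  filter-concat P? (xs ∷ xss) =
    trans (filter-++ P? xs (concat xss)) (cong (filter P? xs ++_) (filter-concat P? xss))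

  nonEmpty? : (xs : List A) → Dec (1 ≤ length xs)
  nonEmpty? xs = 1 ℕ.≤? length xs

  concat-filter-nonEmpty : (xss : List (List A)) → concat (filter nonEmpty? xss) ≡ concat xss
  concat-filter-nonEmpty []              = refl
  concat-filter-nonEmpty ([] ∷ xss)      = concat-filter-nonEmpty xss
  concat-filter-nonEmpty ((x ∷ xs) ∷ xss) = cong ((x ∷ xs) ++_) (concat-filter-nonEmpty xss)

  ∑ : List A → (A → ℕ) → ℕ
  ∑ xs f = sum (map f xs)

  syntax ∑ xs (λ x → e) = ∑[ x ← xs ] e

  ∑-cong : {f g : A → ℕ} (xs : List A) → (∀ {x} → x ∈ xs → f x ≡ g x) → ∑ xs f ≡ ∑ xs g
  ∑-cong []       _  = refl
  ∑-cong (x ∷ xs) eq = cong₂ _+_ (eq (here refl)) (∑-cong xs (eq ∘ there))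

  ∑-mono-≤ : {f g : A → ℕ} (xs : List A) → (∀ {x} → x ∈ xs → f x ≤ g x) → ∑ xs f ≤ ∑ xs g
  ∑-mono-≤ []       _  = z≤n
  ∑-mono-≤ (x ∷ xs) le = +-mono-≤ (le (here refl)) (∑-mono-≤ xs (le ∘ there))

  ∑-+ : (f g : A → ℕ) (xs : List A) → ∑[ x ← xs ] (f x + g x) ≡ ∑ xs f + ∑ xs g
  ∑-+ f g []       = refl
  ∑-+ f g (x ∷ xs) = trans (cong (f x + g x +_) (∑-+ f g xs)) (+-interchange (f x) (g x) _ _)

  ∑-const : (c : ℕ) (xs : List A) → ∑[ x ← xs ] c ≡ length xs * c
  ∑-const c []       = refl
  ∑-const c (x ∷ xs) = cong (c +_) (∑-const c xs)

  ∑-*ˡ : (c : ℕ) (f : A → ℕ) (xs : List A) → ∑[ x ← xs ] (c * f x) ≡ c * ∑ xs f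
  ∑-*ˡ c f []       = sym (*-zeroʳ c)
  ∑-*ˡ c f (x ∷ xs) = trans (cong (c * f x +_) (∑-*ˡ c f xs)) (sym (*-distribˡ-+ c (f x) _))

  ∑-comm : (f : A → B → ℕ) (xs : List A) (ys : List B) →
           ∑[ x ← xs ] ∑ ys (f x) ≡ ∑[ y ← ys ] ∑[ x ← xs ] f x y
  ∑-comm f []       ys = sym (trans (∑-const 0 ys) (*-zeroʳ (length ys)))
  ∑-comm f (x ∷ xs) ys =
    trans (cong (∑ ys (f x) +_) (∑-comm f xs ys)) (sym (∑-+ (f x) (λ y → ∑[ x′ ← xs ] f x′ y) ys))

  ∑-↭ : (f : A → ℕ) {xs ys : List A} → xs ↭ ys → ∑ xs f ≡ ∑ ys f
  ∑-↭ f p = sum-↭ (map⁺ f p)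

  ∑-++ : (f : A → ℕ) (xs ys : List A) → ∑ (xs ++ ys) f ≡ ∑ xs f + ∑ ys f
  ∑-++ f []       ys = refl
  ∑-++ f (x ∷ xs) ys = trans (cong (f x +_) (∑-++ f xs ys)) (sym (+-assoc (f x) _ _))

  ∑-concat : (f : A → ℕ) (xss : List (List A)) → ∑ (concat xss) f ≡ ∑[ xs ← xss ] ∑ xs f
  ∑-concat f []         = refl
  ∑-concat f (xs ∷ xss) = trans (∑-++ f xs (concat xss)) (cong (∑ xs f +_) (∑-concat f xss))

  length-concat : (xss : List (List A)) → length (concat xss) ≡ ∑ xss length
  length-concat []         = refl
  length-concat (xs ∷ xss) = trans (length-++ xs) (cong (length xs +_) (length-concat xss))

  ∑-<-bound : (f : A → ℕ) (c : ℕ) (xs : List A) → (∀ {x} → x ∈ xs → f x < c) →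
              ∑ xs f + length xs ≤ length xs * c
  ∑-<-bound f c xs lt = begin
    ∑ xs f + length xs           ≡⟨ cong (∑ xs f +_) (trans (sym (*-identityʳ _)) (sym (∑-const 1 xs))) ⟩
    ∑ xs f + ∑[ x ← xs ] 1       ≡⟨ sym (∑-+ f (λ _ → 1) xs) ⟩
    ∑[ x ← xs ] (f x + 1)        ≤⟨ ∑-mono-≤ xs (λ x∈ → subst (_≤ c) (+-comm 1 _) (lt x∈)) ⟩
    ∑[ x ← xs ] c                ≡⟨ ∑-const c xs ⟩
    length xs * c                ∎
    where open ≤-Reasoning

  ∑-≤-sole-term : (h : ℕ → ℕ) (js : List ℕ) (j₀ : ℕ) → Unique js →
                  (∀ {j} → j ∈ js → j ≢ j₀ → h j ≡ 0) → ∑ js h ≤ h j₀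
  ∑-≤-sole-term h []       j₀ _       _    = z≤n
  ∑-≤-sole-term h (j ∷ js) j₀ (d ∷ u) vanish with j ≟ j₀
  ... | yes refl = ≤-reflexive (trans (cong (h j +_) rest≡0) (+-identityʳ (h j)))
    where
    rest≡0 : ∑ js h ≡ 0
    rest≡0 = trans (∑-cong js (λ j′∈ → vanish (there j′∈) (λ j′≡j → All.lookup d j′∈ (sym j′≡j))))
                   (trans (∑-const 0 js) (*-zeroʳ (length js)))
  ... | no j≢j₀ = subst (λ z → z + ∑ js h ≤ h j₀) (sym (vanish (here refl) j≢j₀))
                        (∑-≤-sole-term h js j₀ u (vanish ∘ there))

  ∑-mono-≤-but-one : (_≟ᴬ_ : (a b : A) → Dec (a ≡ b)) (x : A) (f g : List A → ℕ) (e : ℕ)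
                     (L : List (List A)) → Unique (concat L) →
                     (∀ {C} → C ∈ L → x ∉ C → f C ≤ g C) → (∀ {C} → C ∈ L → f C ≤ g C + e) →
                     ∑ L f ≤ ∑ L g + e
  ∑-mono-≤-but-one _≟ᴬ_ x f g e []      _ _    _    = z≤n
  ∑-mono-≤-but-one _≟ᴬ_ x f g e (C ∷ L) u away near with Any.any? (x ≟ᴬ_) C
  ... | yes x∈C = begin
    f C + ∑ L f        ≤⟨ +-mono-≤ (near (here refl)) (∑-mono-≤ L (λ D∈ → away (there D∈) (x∉D D∈))) ⟩
    g C + e + ∑ L g    ≡⟨ +-assoc (g C) e _ ⟩
    g C + (e + ∑ L g)  ≡⟨ cong (g C +_) (+-comm e _) ⟩
    g C + (∑ L g + e)  ≡⟨ +-assoc (g C) _ e ⟨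
    g C + ∑ L g + e    ∎
    where
    open ≤-Reasoning
    x∉D : ∀ {D} → D ∈ L → x ∉ D
    x∉D D∈ x∈D = Unique-++-disjoint C u x∈C (∈-concat⁺′ x∈D D∈)
  ... | no x∉C = begin
    f C + ∑ L f        ≤⟨ +-mono-≤ (away (here refl) x∉C) rest ⟩
    g C + (∑ L g + e)  ≡⟨ +-assoc (g C) _ e ⟨
    g C + ∑ L g + e    ∎
    where
    open ≤-Reasoning
    rest : ∑ L f ≤ ∑ L g + e
    rest = ∑-mono-≤-but-one _≟ᴬ_ x f g e L (Unique-++⁻ʳ C u) (away ∘ there) (near ∘ there)

  -- q ≤ p, M ≤ T: values above 2T − M at p places, at least M at q places and at least T at
  -- s places sum to more than (p + q + s) T, since they pair up into sums above 2T.
  average-exceeds : ∀ {p q s T M X Y Z} → 1 ≤ p → q ≤ p → M ≤ T →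
                    p * (T + T + 1) ≤ X + p * M → q * M ≤ Y → s * T ≤ Z → X + Y + Z ≢ (p + q + s) * T
  average-exceeds {q = q} {s} {M = M} {X} {Y} {Z} 1≤p q≤p M≤T heavy light rest total
    with e , refl ← m≤n⇒∃[o]m+o≡n q≤p
    with t , refl ← m≤n⇒∃[o]m+o≡n M≤T
    = <⇒≱ 1≤p (≤-trans (m≤n+m (q + e) (e * t)) (+-cancelˡ-≤ base _ 0 (begin
        base + (e * t + (q + e))                               ≡⟨ expand q e s M t ⟨
        (q + e) * (M + t + (M + t) + 1) + q * M + s * (M + t)  ≤⟨ +-mono-≤ (+-mono-≤ heavy light) rest ⟩
        X + (q + e) * M + Y + Z                                ≡⟨ regroup X Y Z ((q + e) * M) ⟩
        X + Y + Z + (q + e) * M                                ≡⟨ cong (_+ (q + e) * M) total ⟩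
        base                                                   ≡⟨ +-identityʳ base ⟨
        base + 0                                               ∎)))
    where
    open ≤-Reasoning
    base : ℕ
    base = (q + e + q + s) * (M + t) + (q + e) * M
    expand : ∀ q e s M t → (q + e) * (M + t + (M + t) + 1) + q * M + s * (M + t)
                           ≡ (q + e + q + s) * (M + t) + (q + e) * M + (e * t + (q + e))
    expand = solve-∀
    regroup : ∀ X Y Z W → X + W + Y + Z ≡ X + Y + Z + W
    regroup = solve-∀

  -- Counting cliques by order

  δ : ℕ → ℕ → ℕ
  δ m n = if m ≡ᵇ n then 1 else 0

  δ-≡ : ∀ {m n} → m ≡ n → δ m n ≡ 1
  δ-≡ {m} {n} m≡n with m ≡ᵇ n | ≡⇒≡ᵇ m n m≡n
  ... | true | _ = refl

  δ-≢ : ∀ {m n} → m ≢ n → δ m n ≡ 0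
  δ-≢ {m} {n} m≢n with m ≡ᵇ n in eq
  ... | false = refl
  ... | true  = contradiction (≡ᵇ⇒≡ m n (subst Bool.T (sym eq) _)) m≢n

  countOrder : List (List A) → ℕ → ℕ
  countOrder L i = length (filter (λ C → length C ≟ i) L)

  countOrder-∷ : (C : List A) (L : List (List A)) (i : ℕ) →
                 countOrder (C ∷ L) i ≡ δ (length C) i + countOrder L i
  countOrder-∷ C L i with length C ≡ᵇ i
  ... | true  = refl
  ... | false = refl

  countOrder-∑δ : (L : List (List A)) (i : ℕ) → countOrder L i ≡ ∑[ C ← L ] δ (length C) i
  countOrder-∑δ []      i = refl
  countOrder-∑δ (C ∷ L) i = trans (countOrder-∷ C L i) (cong (δ (length C) i +_) (countOrder-∑δ L i))

  countOrder-++ : (L M : List (List A)) (i : ℕ) → countOrder (L ++ M) i ≡ countOrder L i + countOrder M i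
  countOrder-++ L M i = trans (cong length (filter-++ (λ C → length C ≟ i) L M)) (length-++ (filter _ L))

  countOrder-↭ : {L M : List (List A)} → L ↭ M → (i : ℕ) → countOrder L i ≡ countOrder M i
  countOrder-↭ p i = ↭-length (filter-↭ (λ C → length C ≟ i) p)

  countOrder-shorter : (L : List (List A)) (i : ℕ) → All (λ C → length C < i) L → countOrder L i ≡ 0
  countOrder-shorter L i shorter =
    cong length (filter-none (λ C → length C ≟ i) (All.map (λ lt eq → <-irrefl eq lt) shorter))

  -- Count vectors are compared from order k downwards, so keeping the counts above m and raising
  -- the count at m is a lexicographic improvement.
  record Improves (m : ℕ) (old new : List (List A)) : Set where
    field
      same-above : ∀ i → m < i → countOrder new i ≡ countOrder old i
      more-at    : countOrder old m < countOrder new m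

  improves-by-order : (m : ℕ) (old new : List (List A)) → All (λ C → length C < m) old →
                      All (λ C → length C ≤ m) new → Any (λ C → length C ≡ m) new → Improves m old new
  improves-by-order m old new old<m new≤m reaches = record
    { same-above = λ i m<i →
        trans (countOrder-shorter new i (All.map (λ ≤m → ≤-<-trans ≤m m<i) new≤m))
              (sym (countOrder-shorter old i (All.map (λ <m → <-trans <m m<i) old<m)))
    ; more-at    = subst (_< countOrder new m) (sym (countOrder-shorter old m old<m))
                         (filter-some (λ C → length C ≟ m) reaches)
    }

  improves-∷ : {m : ℕ} {C D : List A} {old new : List (List A)} → length C ≡ length D →
               Improves m old new → Improves m (C ∷ old) (D ∷ new)
  improves-∷ {m = m} {C} {D} {old} {new} |C|≡|D| imp = record
    { same-above = λ i m<i → step i (same-above i m<i)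
    ; more-at    = subst₂ _<_ (sym (countOrder-∷ C old m)) (sym (countOrder-∷ D new m))
                          (subst (λ c → δ c m + _ < δ (length D) m + _) (sym |C|≡|D|)
                                 (+-monoʳ-< (δ (length D) m) more-at))
    }
    where
    open Improves imp
    step : ∀ i → countOrder new i ≡ countOrder old i → countOrder (D ∷ new) i ≡ countOrder (C ∷ old) i
    step i eq = trans (countOrder-∷ D new i)
                      (trans (cong₂ (λ c n → δ c i + n) (sym |C|≡|D|) eq) (sym (countOrder-∷ C old i)))

  improves-++ʳ : {m : ℕ} {old new : List (List A)} (rest : List (List A)) →
                 Improves m old new → Improves m (old ++ rest) (new ++ rest)
  improves-++ʳ {m = m} {old} {new} rest imp = record
    { same-above = λ i m<i →
        trans (countOrder-++ new rest i)
              (trans (cong (_+ countOrder rest i) (same-above i m<i)) (sym (countOrder-++ old rest i)))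
    ; more-at    = subst₂ _<_ (sym (countOrder-++ old rest m)) (sym (countOrder-++ new rest m))
                          (+-monoˡ-< (countOrder rest m) more-at)
    }
    where open Improves imp

  LexLe-head : ∀ {x y xs ys} → LexLe (x ∷ xs) (y ∷ ys) → x ≤ y
  LexLe-head (lex-< x<y _) = <⇒≤ x<y
  LexLe-head (lex-≡ _)     = ≤-refl

  LexLe-tail : ∀ {x xs ys} → LexLe (x ∷ xs) (x ∷ ys) → LexLe xs ys
  LexLe-tail (lex-< x<x _) = contradiction x<x (<-irrefl refl)
  LexLe-tail (lex-≡ le)    = le

  applyUpTo-¬LexLe : (F H : ℕ → ℕ) (n J : ℕ) → J < n → (∀ j → j < J → F j ≡ H j) → H J < F J →
                     ¬ LexLe (applyUpTo F n) (applyUpTo H n)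
  applyUpTo-¬LexLe F H (suc n) zero    _         _     H0<F0 le = <⇒≱ H0<F0 (LexLe-head le)
  applyUpTo-¬LexLe F H (suc n) (suc J) (s≤s J<n) agree HJ<FJ le =
    applyUpTo-¬LexLe (F ∘ suc) (H ∘ suc) n J J<n (λ j j<J → agree (suc j) (s≤s j<J)) HJ<FJ
      (LexLe-tail (subst (λ h → LexLe (F 0 ∷ _) (h ∷ _)) (sym (agree 0 z<s)) le))

  OrderBounded : ℕ → List A → Set
  OrderBounded k C = 1 ≤ length C × length C ≤ k

  -- A clique of order c ≥ 1 is counted by the term j of the weighted sum only for c + 2 + j = k.
  order-index : ∀ {k c j} → 1 ≤ c → c ≡ k ∸ (2 + j) → k ∸ (2 + c) ≡ j × (k ∸ 1) ∸ c ≡ suc j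
  order-index {k} {c} {j} 1≤c c≡ =
    subst (λ k → k ∸ (2 + c) ≡ j × (k ∸ 1) ∸ c ≡ suc j) (sym k≡) (index , gap)
    where
    2+j≤k : 2 + j ≤ k
    2+j≤k with 2 + j ℕ.≤? k
    ... | yes le = le
    ... | no  gt = contradiction (trans c≡ (m≤n⇒m∸n≡0 (<⇒≤ (≰⇒> gt)))) (λ c≡0 → <⇒≢ 1≤c (sym c≡0))
    k≡ : k ≡ c + (2 + j)
    k≡ = trans (sym (m∸n+n≡m 2+j≤k)) (cong (_+ (2 + j)) (sym c≡))
    index : c + (2 + j) ∸ (2 + c) ≡ j
    index = trans (cong (_∸ (2 + c)) (trans (+-comm c (2 + j)) (+-assoc 2 j c))) (m+n∸n≡m j c)
    gap : c + (2 + j) ∸ 1 ∸ c ≡ suc j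
    gap = trans (cong (λ n → n ∸ 1 ∸ c) (+-suc c (suc j))) (m+n∸m≡n c (suc j))

  order-weight-≤ : (k c : ℕ) (js : List ℕ) → Unique js → 1 ≤ c →
                   ∑[ j ← js ] (suc j * δ c (k ∸ (2 + j))) ≤ (k ∸ 1) ∸ c
  order-weight-≤ k c js u 1≤c = ≤-trans (∑-≤-sole-term term js j₀ u vanish) (term-j₀ (c ≟ k ∸ (2 + j₀)))
    where
    j₀ : ℕ
    j₀ = k ∸ (2 + c)
    term : ℕ → ℕ
    term j = suc j * δ c (k ∸ (2 + j))
    vanish : ∀ {j} → j ∈ js → j ≢ j₀ → term j ≡ 0
    vanish {j} _ j≢j₀ with c ≟ k ∸ (2 + j)
    ... | yes c≡ = contradiction (sym (proj₁ (order-index {k} 1≤c c≡))) j≢j₀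
    ... | no  c≢ = trans (cong (suc j *_) (δ-≢ c≢)) (*-zeroʳ (suc j))
    term-j₀ : Dec (c ≡ k ∸ (2 + j₀)) → term j₀ ≤ (k ∸ 1) ∸ c
    term-j₀ (yes c≡) = ≤-reflexive (trans (cong (suc j₀ *_) (δ-≡ c≡))
                         (trans (*-identityʳ (suc j₀)) (sym (proj₂ (order-index {k} 1≤c c≡)))))
    term-j₀ (no  c≢) = ≤-trans (≤-reflexive (trans (cong (suc j₀ *_) (δ-≢ c≢)) (*-zeroʳ (suc j₀)))) z≤n

  order-+-gap-≤ : (k c : ℕ) → c ≤ k → c + ((k ∸ 1) ∸ c) ≤ δ c k + (k ∸ 1)
  order-+-gap-≤ k c c≤k with c ≟ k
  ... | yes refl = ≤-trans (≤-reflexive (trans (cong (c +_) (m≤n⇒m∸n≡0 (m∸n≤m c 1))) (+-identityʳ c)))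
                           (subst (λ one → c ≤ one + (c ∸ 1)) (sym (δ-≡ {c} refl)) (m≤n+m∸n c 1))
  ... | no  c≢k  = ≤-reflexive (trans (m+[n∸m]≡n c≤k∸1) (cong (_+ (k ∸ 1)) (sym (δ-≢ c≢k))))
    where
    c≤k∸1 : c ≤ k ∸ 1
    c≤k∸1 = m+n≤o⇒m≤o∸n c (subst (_≤ k) (+-comm 1 c) (≤∧≢⇒< c≤k c≢k))

  ∑-order-weights-≤ : (k : ℕ) (cs : List (List A)) (js : List ℕ) → Unique js → All (OrderBounded k) cs →
                      ∑ cs length + ∑[ j ← js ] (suc j * countOrder cs (k ∸ (2 + j)))
                        ≤ countOrder cs k + (k ∸ 1) * length cs
  ∑-order-weights-≤ k cs js u bounded = begin
    ∑ cs length + ∑[ j ← js ] (suc j * countOrder cs (k ∸ (2 + j)))  ≡⟨ cong (∑ cs length +_) weights≡ ⟩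
    ∑ cs length + ∑ cs weight                                        ≡⟨ ∑-+ length weight cs ⟨
    ∑[ C ← cs ] (length C + weight C)                                ≤⟨ ∑-mono-≤ cs per-clique ⟩
    ∑[ C ← cs ] (δ (length C) k + (k ∸ 1))                           ≡⟨ ∑-+ (λ C → δ (length C) k) _ cs ⟩
    ∑[ C ← cs ] δ (length C) k + ∑[ C ← cs ] (k ∸ 1)                 ≡⟨ cong₂ _+_ (sym (countOrder-∑δ cs k))
                                                                                  count-const ⟩
    countOrder cs k + (k ∸ 1) * length cs                            ∎
    where
    open ≤-Reasoning
    weight : List A → ℕ
    weight C = ∑[ j ← js ] (suc j * δ (length C) (k ∸ (2 + j)))
    weights≡ : ∑[ j ← js ] (suc j * countOrder cs (k ∸ (2 + j))) ≡ ∑ cs weight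
    weights≡ = trans (∑-cong js (λ {j} _ → trans (cong (suc j *_) (countOrder-∑δ cs (k ∸ (2 + j))))
                                         (sym (∑-*ˡ (suc j) (λ C → δ (length C) (k ∸ (2 + j))) cs))))
                     (∑-comm (λ j C → suc j * δ (length C) (k ∸ (2 + j))) js cs)
    count-const : ∑[ C ← cs ] (k ∸ 1) ≡ (k ∸ 1) * length cs
    count-const = trans (∑-const _ cs) (*-comm _ (k ∸ 1))
    per-clique : ∀ {C} → C ∈ cs → length C + weight C ≤ δ (length C) k + (k ∸ 1)
    per-clique C∈ with (1≤c , c≤k) ← All.lookup bounded C∈ =
      ≤-trans (+-monoʳ-≤ _ (order-weight-≤ k _ js u 1≤c)) (order-+-gap-≤ k _ c≤k)

  -- Graphs and clique covers

  module _ {ℓ : ℕ} (G : Graph ℓ) where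

    edge : Fin ℓ → Fin ℓ → ℕ
    edge x y = if adj G x y then 1 else 0

    degIn : Fin ℓ → List (Fin ℓ) → ℕ
    degIn x C = ∑[ y ← C ] edge x y

    CompleteTo : Fin ℓ → List (Fin ℓ) → Set
    CompleteTo x C = All (λ y → adj G x y ≡ true) C

    completeTo? : ∀ x C → Dec (CompleteTo x C)
    completeTo? x C = All.all? (λ y → adj G x y Bool.≟ true) C

    degIn-≤-length : ∀ x C → degIn x C ≤ length C
    degIn-≤-length x []      = z≤n
    degIn-≤-length x (y ∷ C) with adj G x y
    ... | true  = s≤s (degIn-≤-length x C)
    ... | false = m≤n⇒m≤1+n (degIn-≤-length x C)

    degIn-<-length : ∀ x C → ¬ CompleteTo x C → degIn x C < length C
    degIn-<-length x []      incomplete = contradiction [] incomplete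
    degIn-<-length x (y ∷ C) incomplete with adj G x y in xy
    ... | true  = s≤s (degIn-<-length x C (incomplete ∘ (xy ∷_)))
    ... | false = s≤s (degIn-≤-length x C)

    ¬CompleteTo⇒non-neighbour : ∀ {x C} → ¬ CompleteTo x C → ∃ λ y → y ∈ C × adj G x y ≡ false
    ¬CompleteTo⇒non-neighbour {x} {C} incomplete =
      let (y , y∈C , xy≢true) = find (All.¬All⇒Any¬ (λ y → adj G x y Bool.≟ true) C incomplete)
      in y , y∈C , ¬-not xy≢true

    ∈⇒¬CompleteTo : ∀ {x C} → x ∈ C → ¬ CompleteTo x C
    ∈⇒¬CompleteTo x∈ complete with () ← trans (sym (All.lookup complete x∈)) (irrefl G _)

    ∑-degIn-comm : ∀ A C → ∑[ y ← A ] degIn y C ≡ ∑[ q ← C ] degIn q A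
    ∑-degIn-comm A C = trans (∑-comm edge A C)
      (∑-cong C (λ {q} _ → ∑-cong A (λ {y} _ → cong (λ b → if b then 1 else 0) (adj-sym G y q))))

    deg-≡-∑-degIn : (cs : List (List (Fin ℓ))) → concat cs ↭ allFin ℓ →
                    ∀ x → deg G x ≡ ∑[ C ← cs ] degIn x C
    deg-≡-∑-degIn cs p x = trans (∑-↭ (edge x) (↭-sym p)) (∑-concat (edge x) cs)

    IsClique-resp-↭ : ∀ {C D} → C ↭ D → IsClique G C → IsClique G D
    IsClique-resp-↭ = AllPairs-resp-↭ (λ {x} {y} xy → trans (adj-sym G y x) xy)

    IsClique⇒Unique : ∀ {C} → IsClique G C → Unique C
    IsClique⇒Unique []               = []
    IsClique⇒Unique (adjacent ∷ cl) =
      All.map (λ { xy refl → ∈⇒¬CompleteTo (here refl) (xy ∷ []) }) adjacent ∷ IsClique⇒Unique cl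

    pairwise-adjacent⇒IsClique : ∀ {C} → Unique C →
                                 (∀ {x y} → x ∈ C → y ∈ C → x ≢ y → adj G x y ≡ true) → IsClique G C
    pairwise-adjacent⇒IsClique []        _        = []
    pairwise-adjacent⇒IsClique (d ∷ u) adjacent =
      All.tabulate (λ y∈ → adjacent (here refl) (there y∈) (All.lookup d y∈))
      ∷ pairwise-adjacent⇒IsClique u (λ x∈ y∈ → adjacent (there x∈) (there y∈))

  module _ {ℓ k : ℕ} {G : Graph ℓ} (Φ : CliqueCover k G) where

    vertices-unique : Unique (concat (cliques Φ))
    vertices-unique = Unique-resp-↭ (↭-sym (partition Φ)) (Unique.allFin⁺ ℓ)

    cliqueOf : ∀ v → ∃ λ C → v ∈ C × C ∈ cliques Φ
    cliqueOf v = ∈-concat⁻′ (cliques Φ) (∈-resp-↭ (↭-sym (partition Φ)) (∈-allFin v))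

    same-clique : ∀ {v C D} → v ∈ C → C ∈ cliques Φ → v ∈ D → D ∈ cliques Φ → C ≡ D
    same-clique = Unique-concat⇒≡ vertices-unique

    ∑-length-cliques : ∑ (cliques Φ) length ≡ ℓ
    ∑-length-cliques = trans (sym (length-concat (cliques Φ)))
                             (trans (↭-length (partition Φ)) (length-tabulate (λ v → v)))

    count-≤ : ∀ i → count Φ i ≤ ℓ
    count-≤ i = begin
      count Φ i                    ≤⟨ length-filter (λ C → length C ≟ i) (cliques Φ) ⟩
      length (cliques Φ)           ≡⟨ trans (sym (*-identityʳ _)) (sym (∑-const 1 (cliques Φ))) ⟩
      ∑[ C ← cliques Φ ] 1         ≤⟨ ∑-mono-≤ (cliques Φ) (proj₁ ∘ All.lookup (orders Φ)) ⟩
      ∑ (cliques Φ) length         ≡⟨ ∑-length-cliques ⟩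
      ℓ                            ∎
      where open ≤-Reasoning

    order-weights-bound : (js : List ℕ) → Unique js →
                          ℓ + ∑[ j ← js ] (suc j * count Φ (k ∸ (2 + j)))
                            ≤ count Φ k + (k ∸ 1) * length (cliques Φ)
    order-weights-bound js u =
      subst (λ n → n + ∑[ j ← js ] (suc j * count Φ (k ∸ (2 + j)))
                     ≤ count Φ k + (k ∸ 1) * length (cliques Φ))
            ∑-length-cliques (∑-order-weights-≤ k (cliques Φ) js u (orders Φ))

  record Exchange {ℓ k : ℕ} {G : Graph ℓ} (Φ : CliqueCover k G) : Set where
    field
      old rest new  : List (List (Fin ℓ))
      split         : cliques Φ ↭ old ++ rest
      new-cliques   : All (IsClique G) new
      new-bounded   : All (OrderBounded k) new
      same-vertices : concat new ↭ concat old

  module _ {ℓ k : ℕ} {G : Graph ℓ} {Φ : CliqueCover k G} (e : Exchange Φ) where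
    open Exchange e

    exchanged : CliqueCover k G
    exchanged = record
      { cliques    = new ++ rest
      ; areCliques = All.++⁺ new-cliques (All.++⁻ʳ old (All-resp-↭ split (areCliques Φ)))
      ; orders     = All.++⁺ new-bounded (All.++⁻ʳ old (All-resp-↭ split (orders Φ)))
      ; partition  = begin
          concat (new ++ rest)       ≡⟨ concat-++ new rest ⟨
          concat new ++ concat rest  ↭⟨ ++⁺ʳ (concat rest) same-vertices ⟩
          concat old ++ concat rest  ≡⟨ concat-++ old rest ⟩
          concat (old ++ rest)       ↭⟨ concat-↭ (↭-sym split) ⟩
          concat (cliques Φ)         ↭⟨ partition Φ ⟩
          allFin ℓ                   ∎
      }
      where open PermutationReasoning

    exchanged-improves : ∀ {m} → Improves m old new → Improves m (cliques Φ) (cliques exchanged)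
    exchanged-improves imp = record
      { same-above = λ i m<i → trans (same-above i m<i) (sym (countOrder-↭ split i))
      ; more-at    = subst (_< _) (sym (countOrder-↭ split _)) more-at
      }
      where open Improves (improves-++ʳ rest imp)

  countVec-¬LexLe : ∀ {ℓ k m} {G : Graph ℓ} (Φ Ψ : CliqueCover k G) → 1 ≤ m → m ≤ k →
                    Improves m (cliques Φ) (cliques Ψ) → ¬ LexLe (countVec Ψ) (countVec Φ)
  countVec-¬LexLe {k = k} {m} Φ Ψ 1≤m m≤k imp le =
    applyUpTo-¬LexLe (λ j → count Ψ (k ∸ j)) (λ j → count Φ (k ∸ j)) k (k ∸ m) (∸-monoʳ-< 1≤m m≤k)
      (λ j j<k∸m → same-above (k ∸ j) (m<k∸j j<k∸m))
      (subst (λ i → count Φ i < count Ψ i) (sym (m∸[m∸n]≡n m≤k)) more-at)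
      (subst₂ LexLe (map-upTo _ k) (map-upTo _ k) le)
    where
    open Improves imp
    m<k∸j : ∀ {j} → j < k ∸ m → m < k ∸ j
    m<k∸j {j} j<k∸m =
      m+n≤o⇒m≤o∸n (suc m) (subst (_≤ k) (cong suc (+-comm j m)) (m≤o∸n⇒m+n≤o (suc j) m≤k j<k∸m))

  -- Consequences of maximality

  module Maximal {ℓ k : ℕ} {G : Graph ℓ} (Φ : CliqueCover k G) (maximal : IsMaximal Φ) where

    ¬improving-exchange : ∀ {m} (e : Exchange Φ) → 1 ≤ m → m ≤ k →
                          Improves m (Exchange.old e) (Exchange.new e) → ⊥
    ¬improving-exchange e 1≤m m≤k imp =
      countVec-¬LexLe Φ (exchanged e) 1≤m m≤k (exchanged-improves e imp) (maximal (exchanged e))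

    -- Replace the cover cliques meeting K by K and the remnants of those cliques.
    ¬absorbable : (K : List (Fin ℓ)) → IsClique G K → OrderBounded k K →
                  (∀ {C v} → C ∈ cliques Φ → v ∈ C → v ∈ K → length C < length K) → ⊥
    ¬absorbable K clique (1≤|K| , |K|≤k) smaller =
      ¬improving-exchange absorb 1≤|K| |K|≤k
        (improves-by-order (length K) old (K ∷ pieces) old<K (≤-refl ∷ All.map <⇒≤ pieces<K) (here refl))
      where
      open import Data.List.Membership.DecPropositional (Fin._≟_ {ℓ}) using (_∈?_; _∉?_)
      meets? : (C : List (Fin ℓ)) → Dec (Any (_∈ K) C)
      meets? = Any.any? (_∈? K)
      old rest remnants pieces : List (List (Fin ℓ))
      old      = filter meets? (cliques Φ)
      rest     = filter (∁? meets?) (cliques Φ)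
      remnants = map (filter (_∉? K)) old
      pieces   = filter nonEmpty? remnants

      old<K : All (λ C → length C < length K) old
      old<K = All.tabulate λ C∈ → let (C∈Φ , meets) = ∈-filter⁻ meets? C∈
                                      (v , v∈C , v∈K) = find meets
                                  in smaller C∈Φ v∈C v∈K
      pieces<K : All (λ C → length C < length K) pieces
      pieces<K =
        All.filter⁺ nonEmpty? (All.map⁺ (All.map (λ {C} → ≤-<-trans (length-filter (_∉? K) C)) old<K))

      K↭ : K ↭ filter (_∈? K) (concat old)
      K↭ = ∼bag⇒↭ (unique∧set⇒bag (IsClique⇒Unique G clique) unique (mk⇔ to from))
        where
        unique : Unique (filter (_∈? K) (concat old))
        unique = Unique.filter⁺ (_∈? K) (Unique-concat-filter meets? {cliques Φ} (vertices-unique Φ))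
        to : ∀ {v} → v ∈ K → v ∈ filter (_∈? K) (concat old)
        to {v} v∈K with C , v∈C , C∈ ← cliqueOf Φ v =
          ∈-filter⁺ (_∈? K) (∈-concat⁺′ v∈C (∈-filter⁺ meets? C∈ (Any.map (λ { refl → v∈K }) v∈C))) v∈K
        from : ∀ {v} → v ∈ filter (_∈? K) (concat old) → v ∈ K
        from v∈ = proj₂ (∈-filter⁻ (_∈? K) {xs = concat old} v∈)

      absorb : Exchange Φ
      absorb = record
        { old = old ; rest = rest ; new = K ∷ pieces
        ; split         = filter-partition-↭ meets? (cliques Φ)
        ; new-cliques   = clique ∷ All.filter⁺ nonEmpty?
                            (All.map⁺ (All.map (λ {C} → AllPairs.filter⁺ (_∉? K) {C})
                              (All.filter⁺ meets? (areCliques Φ))))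
        ; new-bounded   = (1≤|K| , |K|≤k) ∷ All.zip (All.all-filter nonEmpty? remnants ,
                                                     All.map (λ <K → ≤-trans (<⇒≤ <K) |K|≤k) pieces<K)
        ; same-vertices = begin
            K ++ concat pieces                      ≡⟨ cong (K ++_) (concat-filter-nonEmpty remnants) ⟩
            K ++ concat remnants                    ≡⟨ cong (K ++_) (filter-concat (_∉? K) old) ⟨
            K ++ filter (_∉? K) (concat old)        ↭⟨ ++⁺ʳ _ K↭ ⟩
            filter (_∈? K) (concat old) ++ filter (_∉? K) (concat old)
                                                    ↭⟨ filter-partition-↭ (_∈? K) (concat old) ⟨
            concat old                              ∎
        }
        where open PermutationReasoning

    ¬CompleteTo-cover-clique : ∀ {x C R} → x ∈ C → C ∈ cliques Φ → R ∈ cliques Φ →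
                               length C ≤ length R → length R < k → ¬ CompleteTo G x R
    ¬CompleteTo-cover-clique {x} {C} {R} x∈C C∈ R∈ |C|≤|R| |R|<k complete =
      ¬absorbable (x ∷ R) (complete ∷ All.lookup (areCliques Φ) R∈) (s≤s z≤n , |R|<k) smaller
      where
      smaller : ∀ {D v} → D ∈ cliques Φ → v ∈ D → v ∈ x ∷ R → length D < suc (length R)
      smaller D∈ v∈D (here refl) =
        s≤s (subst (λ E → length E ≤ length R) (same-clique Φ x∈C C∈ v∈D D∈) |C|≤|R|)
      smaller D∈ v∈D (there v∈R) = s≤s (≤-reflexive (cong length (same-clique Φ v∈D D∈ v∈R R∈)))

    clique-over-order-cliques-≤ : ∀ {a} (K : List (Fin ℓ)) → IsClique G K → a < k →
                                  (∀ {v} → v ∈ K → ∃ λ D → v ∈ D × D ∈ cliques Φ × length D ≡ a) →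
                                  length K ≤ a
    clique-over-order-cliques-≤ {a} K clique a<k covered with suc a ℕ.≤? length K
    ... | no  a≱|K| = ≤-pred (≰⇒> a≱|K|)
    ... | yes a<|K| = ⊥-elim (¬absorbable K′ (AllPairs.take⁺ (suc a) clique) bounded smaller)
      where
      K′ : List (Fin ℓ)
      K′ = take (suc a) K
      |K′|≡ : length K′ ≡ suc a
      |K′|≡ = trans (length-take (suc a) K) (m≤n⇒m⊓n≡m a<|K|)
      bounded : OrderBounded k K′
      bounded = subst (1 ≤_) (sym |K′|≡) (s≤s z≤n) , subst (_≤ k) (sym |K′|≡) a<k
      smaller : ∀ {C v} → C ∈ cliques Φ → v ∈ C → v ∈ K′ → length C < length K′
      smaller C∈ v∈C v∈K′ with D , v∈D , D∈ , |D|≡a ← covered (∈-take⁻ (suc a) v∈K′) =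
        subst₂ _<_ (sym (trans (cong length (same-clique Φ v∈C C∈ v∈D D∈)) |D|≡a)) (sym |K′|≡) ≤-refl

    -- Moving x from A into Q and q from Q into B yields cliques of orders |A| − 1, k and |B| + 1.
    ¬CompleteTo-swap : ∀ {x q A Q B} → x ∈ A → A ∈ cliques Φ → Q ∈ cliques Φ → B ∈ cliques Φ →
                       length Q ≡ k → length A ≡ length B → length B < k → x ∉ B →
                       CompleteTo G x Q → q ∈ Q → ¬ CompleteTo G q B
    ¬CompleteTo-swap {x} {q} {A} {Q} {B} x∈A A∈ Q∈ B∈ |Q|≡k |A|≡|B| |B|<k x∉B x→Q q∈Q q→B =
      ¬improving-exchange swap (s≤s z≤n) |B|<k
        (improves-∷ (↭-length Q↭)
          (improves-by-order (suc (length B)) (A ∷ B ∷ []) ((q ∷ B) ∷ pieces)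
            (≤-reflexive (cong suc |A|≡|B|) ∷ ≤-refl ∷ [])
            (≤-refl ∷ All.filter⁺ nonEmpty? {xs = A′ ∷ []} (m≤n⇒m≤1+n (<⇒≤ |A′|<|B|) ∷ []))
            (here refl)))
      where
      Q′ A′ : List (Fin ℓ)
      Q′ = proj₁ (∈⇒↭-∷ q∈Q)
      A′ = proj₁ (∈⇒↭-∷ x∈A)
      Q↭ : Q ↭ q ∷ Q′
      Q↭ = proj₂ (∈⇒↭-∷ q∈Q)
      A↭ : A ↭ x ∷ A′
      A↭ = proj₂ (∈⇒↭-∷ x∈A)
      |A′|<|B| : length A′ < length B
      |A′|<|B| = ≤-reflexive (trans (sym (↭-length A↭)) |A|≡|B|)
      pieces : List (List (Fin ℓ))
      pieces = filter nonEmpty? (A′ ∷ [])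

      A≢Q : A ≢ Q
      A≢Q refl = <⇒≢ |B|<k (trans (sym |A|≡|B|) |Q|≡k)
      B≢Q : B ≢ Q
      B≢Q refl = <⇒≢ |B|<k |Q|≡k
      B≢A : B ≢ A
      B≢A refl = x∉B x∈A
      split : ∃ λ rest → cliques Φ ↭ Q ∷ A ∷ B ∷ rest
      split = ↭-split₃ Q∈ A∈ B∈ A≢Q B≢Q B≢A

      swap : Exchange Φ
      swap = record
        { old = Q ∷ A ∷ B ∷ [] ; rest = proj₁ split ; new = (x ∷ Q′) ∷ (q ∷ B) ∷ pieces
        ; split         = proj₂ split
        ; new-cliques   = (All.tail (All-resp-↭ Q↭ x→Q) ∷ AllPairs.tail (IsClique-resp-↭ G Q↭ (clique Q∈)))
                          ∷ (q→B ∷ clique B∈)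
                          ∷ All.filter⁺ nonEmpty? {xs = A′ ∷ []}
                              (AllPairs.tail (IsClique-resp-↭ G A↭ (clique A∈)) ∷ [])
        ; new-bounded   = (s≤s z≤n , ≤-reflexive (trans (sym (↭-length Q↭)) |Q|≡k))
                          ∷ (s≤s z≤n , |B|<k)
                          ∷ All.zip (All.all-filter nonEmpty? (A′ ∷ []) ,
                                     All.filter⁺ nonEmpty? {xs = A′ ∷ []}
                                       (<⇒≤ (<-trans |A′|<|B| |B|<k) ∷ []))
        ; same-vertices = begin
            x ∷ Q′ ++ q ∷ B ++ concat pieces  ≡⟨ cong (λ ps → x ∷ Q′ ++ q ∷ B ++ ps)
                                                       (concat-filter-nonEmpty (A′ ∷ [])) ⟩
            x ∷ Q′ ++ q ∷ B ++ A′ ++ []       ↭⟨ ↭-prep x (shift q Q′ _) ⟩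
            x ∷ q ∷ Q′ ++ B ++ A′ ++ []       ↭⟨ ↭-swap x q (++⁺ˡ Q′ (shifts B A′)) ⟩
            q ∷ x ∷ Q′ ++ A′ ++ B ++ []       ↭⟨ ↭-prep q (shift x Q′ _) ⟨
            q ∷ Q′ ++ x ∷ A′ ++ B ++ []       ↭⟨ ++⁺ Q↭ (++⁺ʳ _ A↭) ⟨
            Q ++ A ++ B ++ []                 ∎
        }
        where
        open PermutationReasoning
        clique : ∀ {C} → C ∈ cliques Φ → IsClique G C
        clique = All.lookup (areCliques Φ)

  -- The cliques of smallest order

  module SmallestOrder {ℓ k : ℕ} {G : Graph ℓ} (Φ : CliqueCover k G) (maximal : IsMaximal Φ)
                       {a : ℕ} (1≤a : 1 ≤ a) (a<k : a < k) (k≤r : k ≤ count Φ a)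
                       (a≤order : ∀ {C} → C ∈ cliques Φ → a ≤ length C) where
    open Maximal Φ maximal

    As : List (List (Fin ℓ))
    As = filter (λ C → length C ≟ a) (cliques Φ)

    W : List (Fin ℓ)
    W = concat As

    n : ℕ
    n = length W

    ∈As⁻ : ∀ {A} → A ∈ As → A ∈ cliques Φ × length A ≡ a
    ∈As⁻ = ∈-filter⁻ (λ C → length C ≟ a) {xs = cliques Φ}

    ∈W⁻ : ∀ {x} → x ∈ W → ∃ λ A → x ∈ A × A ∈ cliques Φ × length A ≡ a
    ∈W⁻ x∈W = let (A , x∈A , A∈As) = ∈-concat⁻′ As x∈W in A , x∈A , ∈As⁻ A∈As

    W-unique : Unique W
    W-unique = Unique-concat-filter (λ C → length C ≟ a) {cliques Φ} (vertices-unique Φ)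

    n≡ra : n ≡ count Φ a * a
    n≡ra = trans (length-concat As) (trans (∑-cong As (proj₂ ∘ ∈As⁻)) (∑-const a As))

    0<n : 0 < n
    0<n = subst (0 <_) (sym n≡ra) (*-mono-< (<-≤-trans (≤-<-trans z≤n a<k) k≤r) 1≤a)

    edgesTo : List (Fin ℓ) → ℕ
    edgesTo C = ∑[ x ← W ] degIn G x C

    edgesTo-<-order : ∀ {C} → C ∈ cliques Φ → length C < k → edgesTo C + n ≤ n * length C
    edgesTo-<-order {C} C∈ |C|<k = ∑-<-bound (λ x → degIn G x C) (length C) W λ {x} x∈W →
      let (A , x∈A , A∈ , |A|≡a) = ∈W⁻ x∈W
      in degIn-<-length G x C
           (¬CompleteTo-cover-clique x∈A A∈ C∈ (subst (_≤ length C) (sym |A|≡a) (a≤order C∈)) |C|<k)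

    -- By the swap argument, a clique of order a not containing x misses an edge at every vertex
    -- of C, so it sends at most k (a − 1) edges to C.
    edgesTo-completeTo : ∀ {C x} → C ∈ cliques Φ → length C ≡ k → x ∈ W → CompleteTo G x C →
                         edgesTo C + count Φ a * k ≤ count Φ a * (a * k) + k
    edgesTo-completeTo {C} {x} C∈ |C|≡k x∈W x→C = begin
      edgesTo C + length As * k   ≡⟨ cong₂ _+_ (∑-concat (λ y → degIn G y C) As) (sym (∑-const k As)) ⟩
      ∑ As edges + ∑[ A ← As ] k  ≡⟨ ∑-+ edges (λ _ → k) As ⟨
      ∑[ A ← As ] (edges A + k)   ≤⟨ ∑-mono-≤-but-one Fin._≟_ x (λ A → edges A + k) (λ _ → a * k) k
                                                      As W-unique away near ⟩
      ∑[ A ← As ] (a * k) + k     ≡⟨ cong (_+ k) (∑-const (a * k) As) ⟩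
      length As * (a * k) + k     ∎
      where
      open ≤-Reasoning
      edges : List (Fin ℓ) → ℕ
      edges A = ∑[ y ← A ] degIn G y C
      a*k≡ : ∀ {A} → length A ≡ a → length A * length C ≡ a * k
      a*k≡ |A|≡a = cong₂ _*_ |A|≡a |C|≡k
      near : ∀ {A} → A ∈ As → edges A + k ≤ a * k + k
      near {A} A∈As = +-monoˡ-≤ k (begin
        edges A                     ≤⟨ ∑-mono-≤ A (λ {y} _ → degIn-≤-length G y C) ⟩
        ∑[ y ← A ] length C         ≡⟨ ∑-const (length C) A ⟩
        length A * length C         ≡⟨ a*k≡ {A} (proj₂ (∈As⁻ A∈As)) ⟩
        a * k                       ∎)
      away : ∀ {A} → A ∈ As → x ∉ A → edges A + k ≤ a * k
      away {A} A∈As x∉A = begin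
        edges A + k                            ≡⟨ cong₂ _+_ (∑-degIn-comm G A C) (sym |C|≡k) ⟩
        ∑[ q ← C ] degIn G q A + length C      ≤⟨ ∑-<-bound (λ q → degIn G q A) (length A) C misses ⟩
        length C * length A                    ≡⟨ *-comm (length C) (length A) ⟩
        length A * length C                    ≡⟨ a*k≡ {A} |A|≡a ⟩
        a * k                                  ∎
        where
        A∈ : A ∈ cliques Φ
        A∈ = proj₁ (∈As⁻ A∈As)
        |A|≡a : length A ≡ a
        |A|≡a = proj₂ (∈As⁻ A∈As)
        misses : ∀ {q} → q ∈ C → degIn G q A < length A
        misses q∈C =
          let (Ax , x∈Ax , Ax∈ , |Ax|≡a) = ∈W⁻ x∈W
          in degIn-<-length G _ A (¬CompleteTo-swap x∈Ax Ax∈ C∈ A∈ |C|≡k (trans |Ax|≡a (sym |A|≡a))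
                                     (subst (_< k) (sym |A|≡a) a<k) x∉A x→C q∈C)

    edgesTo-k-order : ∀ {C} → C ∈ cliques Φ → length C ≡ k → edgesTo C + n ≤ n * length C
    edgesTo-k-order {C} C∈ |C|≡k with Any.any? (λ x → completeTo? G x C) W
    ... | no none   = ∑-<-bound (λ x → degIn G x C) (length C) W λ {x} x∈W →
                        degIn-<-length G x C (λ x→C → none (lose x∈W x→C))
    ... | yes some  =
      let (x , x∈W , x→C) = find some
      in subst₂ (λ m c → edgesTo C + m ≤ m * c) (sym n≡ra) (sym |C|≡k)
           (+-cancelʳ-≤ k _ _ (begin
              edgesTo C + r * a + k     ≡⟨ +-assoc (edgesTo C) (r * a) k ⟩
              edgesTo C + (r * a + k)   ≤⟨ +-monoʳ-≤ (edgesTo C) ra+k≤rk ⟩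
              edgesTo C + r * k         ≤⟨ edgesTo-completeTo C∈ |C|≡k x∈W x→C ⟩
              r * (a * k) + k           ≡⟨ cong (_+ k) (*-assoc r a k) ⟨
              r * a * k + k             ∎))
      where
      open ≤-Reasoning
      r : ℕ
      r = count Φ a
      ra+k≤rk : r * a + k ≤ r * k
      ra+k≤rk = begin
        r * a + k   ≤⟨ +-monoʳ-≤ (r * a) k≤r ⟩
        r * a + r   ≡⟨ trans (+-comm (r * a) r) (sym (*-suc r a)) ⟩
        r * suc a   ≤⟨ *-monoʳ-≤ r a<k ⟩
        r * k       ∎

    edgesTo-bound : ∀ {C} → C ∈ cliques Φ → edgesTo C + n ≤ n * length C
    edgesTo-bound C∈ with m≤n⇒m<n∨m≡n (proj₂ (All.lookup (orders Φ) C∈))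
    ... | inj₁ |C|<k = edgesTo-<-order C∈ |C|<k
    ... | inj₂ |C|≡k = edgesTo-k-order C∈ |C|≡k

    T : ℕ
    T = ∑ W (deg G)

    degree-sum-bound : T + length (cliques Φ) * n ≤ ℓ * n
    degree-sum-bound = begin
      T + length cs * n                      ≡⟨ cong₂ _+_ T≡ (sym (∑-const n cs)) ⟩
      ∑ cs edgesTo + ∑[ C ← cs ] n           ≡⟨ ∑-+ edgesTo (λ _ → n) cs ⟨
      ∑[ C ← cs ] (edgesTo C + n)            ≤⟨ ∑-mono-≤ cs edgesTo-bound ⟩
      ∑[ C ← cs ] (n * length C)             ≡⟨ ∑-*ˡ n length cs ⟩
      n * ∑ cs length                        ≡⟨ trans (cong (n *_) (∑-length-cliques Φ)) (*-comm n ℓ) ⟩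
      ℓ * n                                  ∎
      where
      open ≤-Reasoning
      cs : List (List (Fin ℓ))
      cs = cliques Φ
      T≡ : T ≡ ∑ cs edgesTo
      T≡ = trans (∑-cong W (λ {x} _ → deg-≡-∑-degIn G cs (partition Φ) x)) (∑-comm (degIn G) W cs)

    HeavyNonEdges : Set
    HeavyNonEdges = ∀ {x y} → x ∈ W → y ∈ W → x ≢ y → adj G x y ≡ false → T + T < n * (deg G x + deg G y)

    -- F = n · deg compares degrees with the average T / n on W without division. With x₀ of
    -- minimum degree (M = F x₀), the heavy vertices (F v + M > 2T) include a non-neighbour of x₀
    -- in every other clique of order a, so there are at least a of them, while the light ones
    -- (F v < T) form a clique, so there are at most a of them.
    module AllNonEdgesHeavy (heavy : HeavyNonEdges) where

      F : Fin ℓ → ℕ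
      F v = n * deg G v

      w : Fin ℓ
      w = proj₁ (0<length⇒∈ {xs = W} 0<n)

      x₀ : Fin ℓ
      x₀ = argmin (deg G) w W

      x₀∈W : x₀ ∈ W
      x₀∈W = argmin-all (deg G) {P = _∈ W} (proj₂ (0<length⇒∈ {xs = W} 0<n)) (All.tabulate (λ v∈ → v∈))

      x₀-minimal : ∀ {v} → v ∈ W → deg G x₀ ≤ deg G v
      x₀-minimal = All.lookup (f[argmin]≤f[xs] w W)

      M : ℕ
      M = F x₀

      heavy? : (v : Fin ℓ) → Dec (T + T < F v + M)
      heavy? v = T + T ℕ.<? F v + M

      light? : (v : Fin ℓ) → Dec (F v < T)
      light? v = F v ℕ.<? T

      P W′ N R : List (Fin ℓ)
      P  = filter heavy? W
      W′ = filter (∁? heavy?) W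
      N  = filter light? W′
      R  = filter (∁? light?) W′

      a≤|P| : a ≤ length P
      a≤|P| = ≤-pred (subst (suc a ≤_) (+-comm (length P) 1) (≤-trans a<k (≤-trans k≤r r≤|P|+1)))
        where
        open ≤-Reasoning
        heavyIn : List (Fin ℓ) → ℕ
        heavyIn A = length (filter heavy? A)
        |P|≡ : length P ≡ ∑ As heavyIn
        |P|≡ = trans (cong length (filter-concat heavy? As))
                     (trans (length-concat (map (filter heavy?) As)) (cong sum (sym (map-∘ As))))
        hit : ∀ {A} → A ∈ As → x₀ ∉ A → 1 ≤ heavyIn A
        hit {A} A∈As x₀∉A =
          let (A₀ , x₀∈A₀ , A₀∈ , |A₀|≡a) = ∈W⁻ x₀∈W
              (A∈ , |A|≡a) = ∈As⁻ A∈As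
              (y , y∈A , x₀y) = ¬CompleteTo⇒non-neighbour G
                                  (¬CompleteTo-cover-clique x₀∈A₀ A₀∈ A∈
                                    (≤-reflexive (trans |A₀|≡a (sym |A|≡a))) (subst (_< k) (sym |A|≡a) a<k))
              x₀≢y = λ x₀≡y → x₀∉A (subst (_∈ A) (sym x₀≡y) y∈A)
              y-heavy = subst (T + T <_) (trans (*-distribˡ-+ n (deg G x₀) (deg G y)) (+-comm M (F y)))
                              (heavy x₀∈W (∈-concat⁺′ y∈A A∈As) x₀≢y x₀y)
          in filter-some heavy? (lose y∈A y-heavy)
        r≤|P|+1 : count Φ a ≤ length P + 1
        r≤|P|+1 = begin
          length As                ≡⟨ trans (sym (*-identityʳ (length As))) (sym (∑-const 1 As)) ⟩
          ∑[ A ← As ] 1            ≤⟨ ∑-mono-≤-but-one Fin._≟_ x₀ (λ _ → 1) heavyIn 1 As W-unique hit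
                                                       (λ {A} _ → m≤n+m 1 (heavyIn A)) ⟩
          ∑ As heavyIn + 1         ≡⟨ cong (_+ 1) |P|≡ ⟨
          length P + 1             ∎

      N⊆W : ∀ {v} → v ∈ N → v ∈ W
      N⊆W v∈N = proj₁ (∈-filter⁻ (∁? heavy?) {xs = W} (proj₁ (∈-filter⁻ light? {xs = W′} v∈N)))

      |N|≤a : length N ≤ a
      |N|≤a = clique-over-order-cliques-≤ N N-clique a<k (∈W⁻ ∘ N⊆W)
        where
        light : ∀ {v} → v ∈ N → F v < T
        light v∈N = proj₂ (∈-filter⁻ light? {xs = W′} v∈N)
        adjacent : ∀ {v u} → v ∈ N → u ∈ N → v ≢ u → adj G v u ≡ true
        adjacent {v} {u} v∈N u∈N v≢u with adj G v u in vu
        ... | true  = refl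
        ... | false = contradiction (heavy (N⊆W v∈N) (N⊆W u∈N) v≢u vu)
                        (<⇒≱ (subst (_< T + T) (sym (*-distribˡ-+ n (deg G v) (deg G u)))
                                    (+-mono-< (light v∈N) (light u∈N))) ∘ <⇒≤)
        N-clique : IsClique G N
        N-clique = pairwise-adjacent⇒IsClique G
                     (Unique.filter⁺ light? (Unique.filter⁺ (∁? heavy?) W-unique)) adjacent

      M≤T : M ≤ T
      M≤T = subst (_≤ T) (∑-const (deg G x₀) W) (∑-mono-≤ W x₀-minimal)

      P-bound : length P * (T + T + 1) ≤ ∑ P F + length P * M
      P-bound = subst₂ _≤_ (∑-const (T + T + 1) P) (trans (∑-+ F (λ _ → M) P) (cong (∑ P F +_) (∑-const M P)))
        (∑-mono-≤ P λ {v} v∈P →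
          subst (_≤ F v + M) (+-comm 1 (T + T)) (proj₂ (∈-filter⁻ heavy? {xs = W} v∈P)))

      N-bound : length N * M ≤ ∑ N F
      N-bound = subst (_≤ ∑ N F) (∑-const M N) (∑-mono-≤ N (λ v∈N → *-monoʳ-≤ n (x₀-minimal (N⊆W v∈N))))

      R-bound : length R * T ≤ ∑ R F
      R-bound = subst (_≤ ∑ R F) (∑-const T R)
        (∑-mono-≤ R (λ v∈R → ≮⇒≥ (proj₂ (∈-filter⁻ (∁? light?) {xs = W′} v∈R))))

      ∑F≡ : ∑ P F + ∑ N F + ∑ R F ≡ (length P + length N + length R) * T
      ∑F≡ = begin
        ∑ P F + ∑ N F + ∑ R F                 ≡⟨ +-assoc (∑ P F) _ _ ⟩
        ∑ P F + (∑ N F + ∑ R F)               ≡⟨ cong (∑ P F +_) (split light? W′) ⟨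
        ∑ P F + ∑ W′ F                        ≡⟨ split heavy? W ⟨
        ∑ W F                                 ≡⟨ ∑-*ˡ n (deg G) W ⟩
        n * T                                 ≡⟨ cong (_* T) |W|≡ ⟩
        (length P + length N + length R) * T  ∎
        where
        open ≡-Reasoning
        split : ∀ {Q : Fin ℓ → Set} (Q? : Decidable Q) xs →
                ∑ xs F ≡ ∑ (filter Q? xs) F + ∑ (filter (∁? Q?) xs) F
        split Q? xs = trans (∑-↭ F (filter-partition-↭ Q? xs)) (∑-++ F (filter Q? xs) _)
        |W′|≡ : length W′ ≡ length N + length R
        |W′|≡ = trans (↭-length (filter-partition-↭ light? W′)) (length-++ N)
        |W|≡ : n ≡ length P + length N + length R
        |W|≡ = trans (↭-length (filter-partition-↭ heavy? W))
                     (trans (length-++ P) (trans (cong (length P +_) |W′|≡) (sym (+-assoc (length P) _ _))))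

      absurd : ⊥
      absurd = average-exceeds (≤-trans 1≤a a≤|P|) (≤-trans |N|≤a a≤|P|) M≤T P-bound N-bound R-bound ∑F≡

    LightNonEdge : Fin ℓ → Fin ℓ → Set
    LightNonEdge x y = x ≢ y × adj G x y ≡ false × n * (deg G x + deg G y) ≤ T + T

    lightNonEdge? : ∀ x y → Dec (LightNonEdge x y)
    lightNonEdge? x y =
      ¬? (x Fin.≟ y) ×-dec (adj G x y Bool.≟ false) ×-dec (n * (deg G x + deg G y) ℕ.≤? T + T)

    non-edge-below-average : ∃ λ x → ∃ λ y → LightNonEdge x y
    non-edge-below-average with Any.any? (λ x → Any.any? (lightNonEdge? x) W) W
    ... | yes found = let (x , _ , found′) = find found
                          (y , _ , light) = find found′
                      in x , y , light
    ... | no none = ⊥-elim (AllNonEdgesHeavy.absurd heavy)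
      where
      heavy : HeavyNonEdges
      heavy {x} {y} x∈W y∈W x≢y xy with n * (deg G x + deg G y) ℕ.≤? T + T
      ... | yes below = contradiction (lose x∈W (lose y∈W (x≢y , xy , below))) none
      ... | no  above = ≰⇒> above

    non-edge-degree-bound : ∃ λ x → ∃ λ y → x ≢ y × adj G x y ≡ false ×
                            deg G x + deg G y + 2 * length (cliques Φ) ≤ 2 * ℓ
    non-edge-degree-bound =
      let (x , y , x≢y , xy , below) = non-edge-below-average
          c = length (cliques Φ)
      in x , y , x≢y , xy , *-cancelʳ-≤ _ _ n {{ℕ.>-nonZero 0<n}} (begin
           (deg G x + deg G y + 2 * c) * n        ≡⟨ regroup (deg G x + deg G y) c n ⟩
           n * (deg G x + deg G y) + 2 * (c * n)  ≤⟨ +-monoˡ-≤ (2 * (c * n)) below ⟩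
           T + T + 2 * (c * n)                    ≡⟨ double T (c * n) ⟩
           2 * (T + c * n)                        ≤⟨ *-monoʳ-≤ 2 degree-sum-bound ⟩
           2 * (ℓ * n)                            ≡⟨ *-assoc 2 ℓ n ⟨
           2 * ℓ * n                              ∎)
      where
      open ≤-Reasoning
      regroup : ∀ D c n → (D + 2 * c) * n ≡ n * D + 2 * (c * n)
      regroup = solve-∀
      double : ∀ T m → T + T + 2 * m ≡ 2 * (T + m)
      double = solve-∀

-- Rational arithmetic

module _ where
  open import Data.Integer using (+_)
  open import Data.Rational using (_+_; _*_; _-_; _≤_)
  open import Data.Rational.Solver using (module +-*-Solver)

  toℚᵘ-frac : ∀ a l → toℚᵘ (frac a (suc l)) ≃ᵘ mkℚᵘ (+ a) l
  toℚᵘ-frac a l = ℚ.toℚᵘ-fromℚᵘ (mkℚᵘ (+ a) l)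

  ≃ᵘ⇒≡ : ∀ {p q p′ q′} → toℚᵘ p ≃ᵘ p′ → toℚᵘ q ≃ᵘ q′ → p′ ≃ᵘ q′ → p ≡ q
  ≃ᵘ⇒≡ p≃ q≃ p′≃q′ = ℚ.toℚᵘ-injective (ℚᵘ.≃-trans p≃ (ℚᵘ.≃-trans p′≃q′ (ℚᵘ.≃-sym q≃)))

  nat-+ : ∀ a b → nat (a ℕ.+ b) ≡ nat a + nat b
  nat-+ a b = ≃ᵘ⇒≡ (toℚᵘ-frac (a ℕ.+ b) 0)
    (ℚᵘ.≃-trans (ℚ.toℚᵘ-homo-+ (nat a) (nat b)) (ℚᵘ.+-cong (toℚᵘ-frac a 0) (toℚᵘ-frac b 0)))
    (*≡* (trans (ℤ.*-identityʳ _) (trans (ℤ.pos-+ a b)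
            (sym (trans (ℤ.*-identityʳ _) (cong₂ ℤ._+_ (ℤ.*-identityʳ (+ a)) (ℤ.*-identityʳ (+ b))))))))

  nat-* : ∀ a b → nat (a ℕ.* b) ≡ nat a * nat b
  nat-* a b = ≃ᵘ⇒≡ (toℚᵘ-frac (a ℕ.* b) 0)
    (ℚᵘ.≃-trans (ℚ.toℚᵘ-homo-* (nat a) (nat b)) (ℚᵘ.*-cong (toℚᵘ-frac a 0) (toℚᵘ-frac b 0)))
    (*≡* (cong (ℤ._* + 1) (ℤ.pos-* a b)))

  frac≡nat*frac1 : ∀ a l → frac a (suc l) ≡ nat a * frac 1 (suc l)
  frac≡nat*frac1 a l = ≃ᵘ⇒≡ (toℚᵘ-frac a l)
    (ℚᵘ.≃-trans (ℚ.toℚᵘ-homo-* (nat a) (frac 1 (suc l))) (ℚᵘ.*-cong (toℚᵘ-frac a 0) (toℚᵘ-frac 1 l)))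
    (*≡* (cong₂ ℤ._*_ (sym (ℤ.*-identityʳ (+ a))) (cong (λ d → + suc d) (+-identityʳ l))))

  nat*frac1≡1 : ∀ l → nat (suc l) * frac 1 (suc l) ≡ 1ℚ
  nat*frac1≡1 l = trans (sym (frac≡nat*frac1 (suc l) l))
    (≃ᵘ⇒≡ (toℚᵘ-frac (suc l) l) ℚᵘ.≃-refl (*≡* (ℤ.*-comm (+ suc l) (+ 1))))

  frac≡0 : ∀ c l → frac c (suc l) ≡ 0ℚ → c ≡ 0
  frac≡0 c l eq with *≡* c*1≡0 ← ℚᵘ.≃-trans (ℚᵘ.≃-sym (toℚᵘ-frac c l)) (ℚ.toℚᵘ-cong eq) =
    ℤ.+-injective (trans (sym (ℤ.*-identityʳ (+ c))) c*1≡0)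

  nat-mono : ∀ {a b} → a ℕ.≤ b → nat a ≤ nat b
  nat-mono {a} {b} a≤b = ℚ.toℚᵘ-cancel-≤
    (ℚᵘ.≤-respʳ-≃ (ℚᵘ.≃-sym (toℚᵘ-frac b 0)) (ℚᵘ.≤-respˡ-≃ (ℚᵘ.≃-sym (toℚᵘ-frac a 0))
      (*≤* (subst₂ ℤ._≤_ (sym (ℤ.*-identityʳ (+ a))) (sym (ℤ.*-identityʳ (+ b))) (ℤ.+≤+ a≤b)))))

  frac1-nonNeg : ∀ l → 0ℚ ≤ frac 1 (suc l)
  frac1-nonNeg l = ℚ.nonNegative⁻¹ (frac 1 (suc l)) {{ℚ.normalize-nonNeg 1 (suc l)}}

  nonNeg-* : ∀ {x y} → 0ℚ ≤ x → 0ℚ ≤ y → 0ℚ ≤ x * y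
  nonNeg-* {x} {y} 0≤x 0≤y =
    ℚ.nonNegative⁻¹ _ {{ℚ.nonNeg*nonNeg⇒nonNeg x {{ℚ.nonNegative 0≤x}} y {{ℚ.nonNegative 0≤y}}}}

  nonNeg-+ : ∀ {x y} → 0ℚ ≤ x → 0ℚ ≤ y → 0ℚ ≤ x + y
  nonNeg-+ {x} {y} 0≤x 0≤y =
    ℚ.nonNegative⁻¹ _ {{ℚ.nonNeg+nonNeg⇒nonNeg x {{ℚ.nonNegative 0≤x}} y {{ℚ.nonNegative 0≤y}}}}

  ≤⇒0≤- : ∀ {p q} → p ≤ q → 0ℚ ≤ q - p
  ≤⇒0≤- {p} {q} p≤q = subst (_≤ q - p) (ℚ.+-inverseʳ p) (ℚ.+-monoˡ-≤ (ℚ.- p) p≤q)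

  0≤-⇒≤ : ∀ {p q} → 0ℚ ≤ q - p → p ≤ q
  0≤-⇒≤ {p} {q} 0≤q-p = subst₂ _≤_ (ℚ.+-identityʳ p) (solve 2 (λ p q → p :+ (q :- p) := q) refl p q)
                                   (ℚ.+-monoʳ-≤ p 0≤q-p)
    where open +-*-Solver

  -- Twice the slack of the conclusion is a nonnegative combination of the slacks s₁, s₂, s₃ of the
  -- three hypotheses, once K w = 1 and L u = 1 are used.
  slack-certificate : ∀ (γ d ε w u D c t N L K : ℚ) → K * w ≡ 1ℚ → L * u ≡ 1ℚ → 0ℚ ≤ K → 0ℚ ≤ u →
                      nat 2 * (1ℚ - w + γ - d - nat 2 * ε) * L ≤ D → D + nat 2 * c ≤ nat 2 * L →
                      L + t ≤ N + K * c → t * u + K * γ - K * (d + nat 2 * ε) ≤ N * u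
  slack-certificate γ d ε w u D c t N L K Kw≡1 Lu≡1 0≤K 0≤u h₁ h₂ h₃ =
    0≤-⇒≤ (ℚ.*-cancelˡ-≤-pos two (begin
      two * 0ℚ   ≡⟨ ℚ.*-zeroʳ two ⟩
      0ℚ         ≤⟨ 0≤R ⟩
      R          ≡⟨ twice-gap ⟨
      two * gap  ∎))
    where
    open ℚ.≤-Reasoning
    open +-*-Solver
    two β gap s₁ s₂ s₃ R : ℚ
    two = nat 2
    β   = γ - d - two * ε
    gap = N * u - (t * u + K * γ - K * (d + two * ε))
    s₁  = D - two * (1ℚ - w + γ - d - two * ε) * L
    s₂  = two * L - (D + two * c)
    s₃  = N + K * c - (L + t)
    R   = (s₁ + s₂) * K * u + two * s₃ * u
    0≤R : 0ℚ ≤ R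
    0≤R = nonNeg-+ (nonNeg-* (nonNeg-* (nonNeg-+ (≤⇒0≤- h₁) (≤⇒0≤- h₂)) 0≤K) 0≤u)
                   (nonNeg-* (nonNeg-* (nat-mono {0} {2} z≤n) (≤⇒0≤- h₃)) 0≤u)
    twice-gap : two * gap ≡ R
    twice-gap = begin-equality
      two * gap
        ≡⟨ solve 12 (λ two γ d ε w u D c t N L K →
             two :* (N :* u :- (t :* u :+ K :* γ :- K :* (d :+ two :* ε)))
             := ((D :- two :* (con 1ℚ :- w :+ γ :- d :- two :* ε) :* L) :+ (two :* L :- (D :+ two :* c)))
                  :* K :* u
                :+ two :* (N :+ K :* c :- (L :+ t)) :* u
                :- two :* (L :* u) :* (K :* w :- con 1ℚ)
                :+ two :* K :* (γ :- d :- two :* ε) :* (L :* u :- con 1ℚ))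
             refl two γ d ε w u D c t N L K ⟩
      R - two * (L * u) * (K * w - 1ℚ) + two * K * β * (L * u - 1ℚ)
        ≡⟨ cong₂ (λ x y → R - two * (L * u) * (x - 1ℚ) + two * K * β * (y - 1ℚ)) Kw≡1 Lu≡1 ⟩
      R - two * (L * u) * (1ℚ - 1ℚ) + two * K * β * (1ℚ - 1ℚ)
        ≡⟨ solve 3 (λ R x y → R :- x :* (con 1ℚ :- con 1ℚ) :+ y :* (con 1ℚ :- con 1ℚ) := R) refl
                   R (two * (L * u)) (two * K * β) ⟩
      R ∎

  foldr-nat*frac : ∀ l (w c : ℕ → ℕ) (js : List ℕ) →
                   foldr _+_ 0ℚ (map (λ j → nat (w j) * frac (c j) (suc l)) js)
                     ≡ nat (∑[ j ← js ] (w j ℕ.* c j)) * frac 1 (suc l)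
  foldr-nat*frac l w c []       = sym (ℚ.*-zeroˡ (frac 1 (suc l)))
  foldr-nat*frac l w c (j ∷ js) = begin-equality
    nat (w j) * frac (c j) (suc l) + foldr _+_ 0ℚ (map (λ j → nat (w j) * frac (c j) (suc l)) js)
      ≡⟨ cong₂ _+_ (cong (nat (w j) *_) (frac≡nat*frac1 (c j) l)) (foldr-nat*frac l w c js) ⟩
    nat (w j) * (nat (c j) * u) + nat S * u
      ≡⟨ solve 4 (λ a b s u → a :* (b :* u) :+ s :* u := (a :* b :+ s) :* u) refl
                 (nat (w j)) (nat (c j)) (nat S) u ⟩
    (nat (w j) * nat (c j) + nat S) * u
      ≡⟨ cong (_* u) (trans (nat-+ (w j ℕ.* c j) S) (cong (_+ nat S) (nat-* (w j) (c j)))) ⟨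
    nat (w j ℕ.* c j ℕ.+ S) * u ∎
    where
    open ℚ.≤-Reasoning
    open +-*-Solver
    u : ℚ
    u = frac 1 (suc l)
    S : ℕ
    S = ∑[ j ← js ] (w j ℕ.* c j)

  counts⇒ratio-bound : ∀ m l (γ d ε : ℚ) (D c t N : ℕ) →
                       nat 2 * (1ℚ - frac 1 (suc m) + γ - d - nat 2 * ε) * nat (suc l) ≤ nat D →
                       D ℕ.+ 2 ℕ.* c ℕ.≤ 2 ℕ.* suc l → suc l ℕ.+ t ℕ.≤ N ℕ.+ suc m ℕ.* c →
                       nat t * frac 1 (suc l) + nat (suc m) * γ - nat (suc m) * (d + nat 2 * ε)
                         ≤ frac N (suc l)
  counts⇒ratio-bound m l γ d ε D c t N dense degrees weights =
    subst (_ ≤_) (sym (frac≡nat*frac1 N l))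
      (slack-certificate γ d ε (frac 1 (suc m)) (frac 1 (suc l)) (nat D) (nat c) (nat t) (nat N)
                         (nat (suc l)) (nat (suc m)) (nat*frac1≡1 m) (nat*frac1≡1 l)
                         (nat-mono {0} {suc m} z≤n) (frac1-nonNeg l) dense degrees′ weights′)
    where
    degrees′ : nat D + nat 2 * nat c ≤ nat 2 * nat (suc l)
    degrees′ = subst₂ _≤_ (trans (nat-+ D _) (cong (λ q → nat D + q) (nat-* 2 c))) (nat-* 2 (suc l))
                          (nat-mono degrees)
    weights′ : nat (suc l) + nat t ≤ nat N + nat (suc m) * nat c
    weights′ = subst₂ _≤_ (nat-+ (suc l) t) (trans (nat-+ N _) (cong (λ q → nat N + q) (nat-* (suc m) c)))
                          (nat-mono weights)

  φ≡0⇒order-≥ : ∀ {l k i₀} {G : Graph (suc l)} (Φ : CliqueCover k G) →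
                (∀ i → 1 ℕ.≤ i → i ℕ.< i₀ → φ Φ i ≡ 0ℚ) → ∀ {C} → C ∈ cliques Φ → i₀ ℕ.≤ length C
  φ≡0⇒order-≥ {l} Φ φ≡0 {C} C∈ = ≮⇒≥ λ |C|<i₀ →
    <⇒≢ (filter-some (λ D → length D ℕ.≟ length C) (lose C∈ refl))
        (sym (frac≡0 _ l (φ≡0 (length C) (proj₁ (All.lookup (orders Φ) C∈)) |C|<i₀)))

open import Data.Nat using (_∸_; _≥_; _≤_; _<_)
open import Data.Rational using (_+_; _-_; _*_)

proposition2p7 : (k : ℕ) → k ≥ 2 → (γ d ε : ℚ) → (ℓ : ℕ) → (G : Graph ℓ) →
    (∀ (x y : Fin ℓ) → ¬ (x ≡ y) → adj G x y ≡ false →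
      ℚ._≤_ (nat 2 * (1ℚ - frac 1 (k ∸ 1) + γ - d - nat 2 * ε) * nat ℓ)
            (nat (deg G x ℕ.+ deg G y))) →
    (Φ : CliqueCover k G) → IsMaximal Φ →
    (i₀ : ℕ) → 1 ≤ i₀ → i₀ < k → count Φ i₀ ≥ k →
    (∀ i → 1 ≤ i → i < i₀ → count Φ i < k) →
    (∀ i → 1 ≤ i → i < i₀ → φ Φ i ≡ ℚ.0ℚ) →
    ℚ._≤_ (sumFromTo 2 (k ∸ i₀) (λ i → nat (i ∸ 1) * φ Φ (k ∸ i))
             + nat (k ∸ 1) * γ - nat (k ∸ 1) * (d + nat 2 * ε))
          (φ Φ k)
proposition2p7 (suc zero) (s≤s ()) _ _ _ _ _ _ _ _ _ _ _ _ _ _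
proposition2p7 (suc (suc m)) _ γ d ε zero G _ Φ _ i₀ _ _ k≤count _ _ =
  contradiction (≤-trans k≤count (count-≤ Φ i₀)) λ ()
proposition2p7 k@(suc (suc m)) _ γ d ε (suc l) G dense Φ maximal i₀ 1≤i₀ i₀<k k≤count _ φ≡0 =
  let (x , y , x≢y , xy , degrees) =
        SmallestOrder.non-edge-degree-bound Φ maximal 1≤i₀ i₀<k k≤count (φ≡0⇒order-≥ Φ φ≡0)
      terms = suc (k ∸ i₀) ∸ 2
  -- sumFromTo unfolds to the sum over j < terms of nat (suc j) * φ Φ (k ∸ (2 + j)).
  in subst (λ s → ℚ._≤_ (s + nat (suc m) * γ - nat (suc m) * (d + nat 2 * ε)) (φ Φ k))
       (sym (foldr-nat*frac l suc (λ j → count Φ (k ∸ (2 ℕ.+ j))) (upTo terms)))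
       (counts⇒ratio-bound m l γ d ε (deg G x ℕ.+ deg G y) (length (cliques Φ)) _ (count Φ k)
         (dense x y x≢y xy) degrees (order-weights-bound Φ (upTo terms) (Unique.upTo⁺ terms)))
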